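{- Let $(G,\lambda)$ be a $k$-partite $d$-clause graph over $X$ and let $V_i$ be one of its parts. If the family $\lambda(V_i)=\{\lambda(v):v\in V_i\}$ contains a sunflower $\mathcal{S}$ of size at least $s=(k-1)d+2$, then for every vertex $v$ with $\lambda(v)\in\mathcal{S}$, the CGIS instances $(G,\lambda,X)$ and $(G-v,\lambda,X)$ are equivalent (one is a yes-instance if and only if the other is).
   Context: For a variable set $X$ let $\mathcal{C}^d_X$ be the set of all clauses (sets of literals, no literal together with its negation) with exactly $d$ distinct literals over $X$. Two clauses clash if they contain a pair of opposite literals. A $k$-partite $d$-clause graph over $X$ is $(G,\lambda)$ with $G$ undirected, $V(G)=V_1\uplus\dots\uplus V_k$, $\lambda\colon V(G)\to\mathcal{C}^d_X$ injective on each $V_i$, and $u\in V_i$, $v\in V_j$ adjacent iff $i\ne j$ and $\lambda(u),\lambda(v)$ clash. CGIS: decide whether there is an independent set $S$ with $|S\cap V_i|=1$ for all $i$. $G-v$ is $G$ with $v$ and its incident edges removed (with $\lambda$ restricted, and $v$ removed from its part). A subfamily $\mathcal{S}$ of a set family is a sunflower if there is a set $C$ (the core) with $F\cap F'=C$ for all distinct $F,F'\in\mathcal{S}$. -}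

module Defs where

open import Data.Nat using (ℕ; _+_; _*_; _∸_)
open import Data.Fin using (Fin)
open import Data.Fin.Subset using (Subset; _∩_; ∣_∣; Nonempty; Empty)
open import Data.Product using (Σ; ∃; _×_; _,_; proj₁; proj₂)
open import Data.Sum using (_⊎_)
open import Data.List using (List)
open import Data.List.Membership.Propositional using (_∈_)
open import Relation.Nullary using (¬_)
open import Relation.Binary.PropositionalEquality using (_≡_; _≢_)
open import Function.Bundles using (_⇔_; mk⇔)
open import Data.Refinement using (Refinement; value; value-injective)
open import Data.List.Relation.Unary.Unique.Propositional using (Unique)

-- Variable set X = Fin n.
-- A clause (set of literals) is represented by the pair (P , N) of
-- the set of variables occurring positively and the set occurring negatively.
record Clause (n : ℕ) : Set where
  constructor clause
  field
    pos : Subset n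
    neg : Subset n
open Clause public

_∩ᶜ_ : ∀ {n} → Clause n → Clause n → Clause n
C ∩ᶜ D = clause (pos C ∩ pos D) (neg C ∩ neg D)

IsDClause : ∀ {n} → ℕ → Clause n → Set
IsDClause d C = Empty (pos C ∩ neg C) × (∣ pos C ∣ + ∣ neg C ∣ ≡ d)

Clash : ∀ {n} → Clause n → Clause n → Set
Clash C D = Nonempty (pos C ∩ neg D) ⊎ Nonempty (neg C ∩ pos D)

-- k-partite d-clause graph over X = Fin n, with vertex type V.
-- part u = i means u ∈ V_{i}; parts are indexed by Fin k.
record ClauseGraph (n k d : ℕ) (V : Set) : Set₁ where
  field
    part    : V → Fin k
    label   : V → Clause n
    label-d : ∀ u → IsDClause d (label u)
    inj     : ∀ u w → part u ≡ part w → label u ≡ label w → u ≡ w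
    Adj     : V → V → Set
    adj-iff : ∀ u w → Adj u w ⇔ ((part u ≢ part w) × Clash (label u) (label w))
open ClauseGraph public

delete : ∀ {n k d V} → ClauseGraph n k d V → (v : V) → ClauseGraph n k d (Refinement V (λ u → u ≢ v))
delete G v = record
  { part    = λ u → part G (value u)
  ; label   = λ u → label G (value u)
  ; label-d = λ u → label-d G (value u)
  ; inj     = λ u w p l → value-injective (inj G (value u) (value w) p l)
  ; Adj     = λ u w → Adj G (value u) (value w)
  ; adj-iff = λ u w → adj-iff G (value u) (value w)
  }

-- CGIS yes-instance: an independent set S (as a predicate on vertices)
-- with |S ∩ V_i| = 1 for every part i.
IsIndependent : ∀ {n k d V} → ClauseGraph n k d V → (V → Set) → Set
IsIndependent G S = ∀ u w → S u → S w → ¬ Adj G u w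

OneFromEachPart : ∀ {n k d V} → ClauseGraph n k d V → (V → Set) → Set
OneFromEachPart {k = k} {V = V} G S =
  ∀ (i : Fin k) → Σ V (λ u → (S u × part G u ≡ i) × (∀ w → S w → part G w ≡ i → w ≡ u))

CGIS : ∀ {n k d V} → ClauseGraph n k d V → Set₁
CGIS {V = V} G = Σ (V → Set) (λ S → IsIndependent G S × OneFromEachPart G S)

InLabelsOfPart : ∀ {n k d V} → ClauseGraph n k d V → Fin k → Clause n → Set
InLabelsOfPart {V = V} G i C = Σ V (λ u → part G u ≡ i × label G u ≡ C)

IsSunflower : ∀ {n} → List (Clause n) → Set
IsSunflower {n} 𝒮 = Σ (Clause n) (λ core →
  ∀ F F' → F ∈ 𝒮 → F' ∈ 𝒮 → F ≢ F' → F ∩ᶜ F' ≡ core)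

{-# OPTIONS --safe #-}
-- If an independent transversal picks the vertex v, its other k − 1 clauses do not clash with
-- λ(v). A literal shared by two petals lies in the core and hence in λ(v), so each of these
-- d-clauses clashes with at most d petals. As |𝒮| ≥ (k − 1)d + 2, some petal other than λ(v)
-- clashes with none of them, and the vertex of the same part carrying that petal can replace v.
module Submission where

open import Defs
open import Level using (Level)
open import Data.Nat using (ℕ; _+_; _*_; _∸_; _≤_; _<_; z≤n; s≤s)
open import Data.Nat.Properties
  using (≤-trans; ≤-reflexive; +-mono-≤; +-monoʳ-≤; +-suc; +-comm; n≤1+n; n<1+n; m≤n⇒m≤1+n; <-irrefl; *-identityʳ; module ≤-Reasoning)
import Data.Bool as Bool
open import Data.Fin using (Fin; zero; suc)
open import Data.Fin.Properties using (_≟_; any?)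
open import Data.Fin.Subset using (Subset; _∩_; ∣_∣; ∁; ⁅_⁆; inside; outside) renaming (_∈_ to _∈ₛ_)
open import Data.Fin.Subset.Properties
  using (_∈?_; nonempty?; x∈p∩q⁺; x∈p∩q⁻; ∩-comm; ∣∁p∣≡n∸∣p∣; ∣⁅x⁆∣≡1; x∉p⇒x∈∁p; x∈∁p⇒x∉p; x≢y⇒x∉⁅y⁆; x∉⁅y⁆⇒x≢y)
open import Data.Vec.Base using ([]; _∷_; here; there)
open import Data.Vec.Properties using (≡-dec)
open import Data.Vec.Functional using (updateAt)
open import Data.Vec.Functional.Properties using (updateAt-updates; updateAt-minimal)
open import Data.List using (List; []; _∷_; length; filter)
open import Data.List.Properties using (filter-all; filter-none)
open import Data.List.Membership.Propositional using (_∈_; find)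
open import Data.List.Relation.Unary.Any using (here; there)
open import Data.List.Relation.Unary.All using (All; all?)
import Data.List.Relation.Unary.All as All
open import Data.List.Relation.Unary.All.Properties using (¬All⇒Any¬)
open import Data.List.Relation.Unary.AllPairs using (_∷_)
open import Data.List.Relation.Unary.Unique.Propositional using (Unique)
open import Data.Product using (Σ; ∃-syntax; _×_; _,_; proj₁; proj₂)
open import Data.Sum using (inj₁; inj₂)
open import Data.Refinement using (value; _,_)
open import Data.Irrelevant using ([_])
open import Function using (_∘_; const)
open import Function.Bundles using (_⇔_; mk⇔; Equivalence)
open import Relation.Nullary using (¬_; yes; no; contradiction)
open import Relation.Nullary.Decidable using (map′; _×-dec_; _⊎-dec_)
open import Relation.Unary using (Pred; Decidable; _⊆_; _∪_)
open import Relation.Unary.Properties using (_∪?_)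
open import Relation.Binary.Definitions using (DecidableEquality)
open import Relation.Binary.PropositionalEquality
  using (_≡_; _≢_; refl; sym; trans; cong; cong₂; subst; subst₂; module ≡-Reasoning)

private
  variable
    a ℓ ℓ₁ ℓ₂ : Level
    A : Set a
    V : Set
    m n k d : ℕ

count : {P : Pred A ℓ} → Decidable P → List A → ℕ
count P? = length ∘ filter P?

count-mono : {P : Pred A ℓ₁} {Q : Pred A ℓ₂} (P? : Decidable P) (Q? : Decidable Q) →
             P ⊆ Q → ∀ xs → count P? xs ≤ count Q? xs
count-mono P? Q? P⊆Q []       = z≤n
count-mono P? Q? P⊆Q (x ∷ xs) with ih ← count-mono P? Q? P⊆Q xs | P? x | Q? x
... | yes _  | yes _  = s≤s ih
... | yes px | no ¬qx = contradiction (P⊆Q px) ¬qx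
... | no _   | yes _  = m≤n⇒m≤1+n ih
... | no _   | no _   = ih

count-∪ : {P : Pred A ℓ₁} {Q : Pred A ℓ₂} (P? : Decidable P) (Q? : Decidable Q) →
          ∀ xs → count (P? ∪? Q?) xs ≤ count P? xs + count Q? xs
count-∪ P? Q? []       = z≤n
count-∪ P? Q? (x ∷ xs) with ih ← count-∪ P? Q? xs | P? x | Q? x
... | yes _ | yes _ = s≤s (≤-trans ih (+-monoʳ-≤ (count P? xs) (n≤1+n _)))
... | yes _ | no _  = s≤s ih
... | no _  | yes _ = ≤-trans (s≤s ih) (≤-reflexive (sym (+-suc (count P? xs) (count Q? xs))))
... | no _  | no _  = ih

count≡0 : {P : Pred A ℓ} (P? : Decidable P) {xs : List A} → All (¬_ ∘ P) xs → count P? xs ≡ 0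
count≡0 P? none = cong length (filter-none P? none)

count-≤1 : {P : Pred A ℓ} (P? : Decidable P) {xs : List A} → Unique xs →
           (∀ {x y} → x ∈ xs → y ∈ xs → P x → P y → ¬ x ≢ y) → count P? xs ≤ 1
count-≤1 P? {[]}     _                  _         = z≤n
count-≤1 {P = P} P? {x ∷ xs} (x∉xs ∷ unique-xs) atMostOne with P? x
... | yes px = s≤s (≤-reflexive (count≡0 P? (All.tabulate others-fail)))
  where
  others-fail : ∀ {y} → y ∈ xs → ¬ P y
  others-fail y∈xs py = atMostOne (here refl) (there y∈xs) px py (All.lookup x∉xs y∈xs)
... | no _   = count-≤1 P? unique-xs (λ x∈ y∈ → atMostOne (there x∈) (there y∈))

count<length⇒∃¬ : {P : Pred A ℓ} (P? : Decidable P) (xs : List A) →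
                  count P? xs < length xs → ∃[ x ] x ∈ xs × ¬ P x
count<length⇒∃¬ P? xs count<length with all? P? xs
... | yes all-P = contradiction count<length (<-irrefl (cong length (filter-all P? all-P)))
... | no ¬all-P = find (¬All⇒Any¬ P? xs ¬all-P)

Union : Subset m → (Fin m → Pred A ℓ) → Pred A ℓ
Union p H y = ∃[ x ] x ∈ₛ p × H x y

union? : (p : Subset m) {H : Fin m → Pred A ℓ} → (∀ x → Decidable (H x)) → Decidable (Union p H)
union? p H? y = any? (λ x → x ∈? p ×-dec H? x y)

count-Union : (p : Subset m) {H : Fin m → Pred A ℓ} (H? : ∀ x → Decidable (H x)) {c : ℕ} (ys : List A) →
              (∀ {x} → x ∈ₛ p → count (H? x) ys ≤ c) → count (union? p H?) ys ≤ ∣ p ∣ * c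
count-Union []            H? ys bound =
  ≤-reflexive (count≡0 (union? [] H?) {ys} (All.tabulate (λ { _ (() , _) })))
count-Union (outside ∷ p) {H} H? ys bound =
  ≤-trans (count-mono _ _ shift ys) (count-Union p (H? ∘ suc) ys (λ x∈p → bound (there x∈p)))
  where
  shift : Union (outside ∷ p) H ⊆ Union p (H ∘ suc)
  shift (suc x , there x∈p , h) = x , x∈p , h
count-Union (inside ∷ p)  {H} H? {c} ys bound = begin
  count (union? (inside ∷ p) H?) ys
    ≤⟨ count-mono _ (H? zero ∪? union? p (H? ∘ suc)) split ys ⟩
  count (H? zero ∪? union? p (H? ∘ suc)) ys
    ≤⟨ count-∪ (H? zero) (union? p (H? ∘ suc)) ys ⟩
  count (H? zero) ys + count (union? p (H? ∘ suc)) ys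
    ≤⟨ +-mono-≤ (bound here) (count-Union p (H? ∘ suc) ys (λ x∈p → bound (there x∈p))) ⟩
  c + ∣ p ∣ * c ∎
  where
  open ≤-Reasoning
  split : Union (inside ∷ p) H ⊆ H zero ∪ Union p (H ∘ suc)
  split (zero  , here       , h) = inj₁ h
  split (suc x , there x∈p , h) = inj₂ (x , x∈p , h)

∣∁⁅x⁆∣≡n∸1 : (x : Fin n) → ∣ ∁ ⁅ x ⁆ ∣ ≡ n ∸ 1
∣∁⁅x⁆∣≡n∸1 {n} x = trans (∣∁p∣≡n∸∣p∣ ⁅ x ⁆) (cong (n ∸_) (∣⁅x⁆∣≡1 x))

_≟ᶜ_ : DecidableEquality (Clause n)
clause p q ≟ᶜ clause p′ q′ =
  map′ (λ (p≡p′ , q≡q′) → cong₂ clause p≡p′ q≡q′) (λ C≡C′ → cong pos C≡C′ , cong neg C≡C′)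
       (≡-dec Bool._≟_ p p′ ×-dec ≡-dec Bool._≟_ q q′)

clash? : (C : Clause n) → Decidable (Clash C)
clash? C D = nonempty? (pos C ∩ neg D) ⊎-dec nonempty? (neg C ∩ pos D)

clash-sym : {C D : Clause n} → Clash C D → Clash D C
clash-sym {C = C} {D} (inj₁ (x , x∈)) = inj₂ (x , subst (x ∈ₛ_) (∩-comm (pos C) (neg D)) x∈)
clash-sym {C = C} {D} (inj₂ (x , x∈)) = inj₁ (x , subst (x ∈ₛ_) (∩-comm (neg C) (pos D)) x∈)

module _ (sel : Clause n → Subset n) (sel-∩ᶜ : ∀ C D → sel (C ∩ᶜ D) ≡ sel C ∩ sel D)
         {𝒮 : List (Clause n)} (sunflower : IsSunflower 𝒮) {L : Clause n} (L∈𝒮 : L ∈ 𝒮) where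

  ∈-two-petals⇒∈-petal : ∀ {F F′ x} → F ∈ 𝒮 → F′ ∈ 𝒮 → F ≢ F′ → x ∈ₛ sel F → x ∈ₛ sel F′ → x ∈ₛ sel L
  ∈-two-petals⇒∈-petal {F} {F′} {x} F∈𝒮 F′∈𝒮 F≢F′ x∈F x∈F′ with F ≟ᶜ L
  ... | yes refl = x∈F
  ... | no F≢L   = proj₂ (x∈p∩q⁻ (sel F) (sel L) (subst (x ∈ₛ_) shared (x∈p∩q⁺ (x∈F , x∈F′))))
    where
    open ≡-Reasoning
    core = proj₁ sunflower
    shared : sel F ∩ sel F′ ≡ sel F ∩ sel L
    shared = begin
      sel F ∩ sel F′  ≡⟨ sel-∩ᶜ F F′ ⟨
      sel (F ∩ᶜ F′)   ≡⟨ cong sel (proj₂ sunflower F F′ F∈𝒮 F′∈𝒮 F≢F′) ⟩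
      sel core        ≡⟨ cong sel (proj₂ sunflower F L F∈𝒮 L∈𝒮 F≢L) ⟨
      sel (F ∩ᶜ L)    ≡⟨ sel-∩ᶜ F L ⟩
      sel F ∩ sel L   ∎

  petals-containing-≤1 : Unique 𝒮 → ∀ {x} → ¬ x ∈ₛ sel L → count (λ F → x ∈? sel F) 𝒮 ≤ 1
  petals-containing-≤1 unique x∉L =
    count-≤1 _ unique (λ F∈𝒮 F′∈𝒮 x∈F x∈F′ F≢F′ → x∉L (∈-two-petals⇒∈-petal F∈𝒮 F′∈𝒮 F≢F′ x∈F x∈F′))

clashing-petals-≤ : {𝒮 : List (Clause n)} → Unique 𝒮 → IsSunflower 𝒮 → {L : Clause n} → L ∈ 𝒮 →
                    (C : Clause n) → ¬ Clash C L → count (clash? C) 𝒮 ≤ ∣ pos C ∣ + ∣ neg C ∣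
clashing-petals-≤ {𝒮 = 𝒮} unique sunflower L∈𝒮 C no-clash = begin
  count (clash? C) 𝒮
    ≤⟨ count-mono (clash? C) (via-pos ∪? via-neg) split 𝒮 ⟩
  count (via-pos ∪? via-neg) 𝒮
    ≤⟨ count-∪ via-pos via-neg 𝒮 ⟩
  count via-pos 𝒮 + count via-neg 𝒮
    ≤⟨ +-mono-≤ (count-Union (pos C) _ 𝒮 positive-literal) (count-Union (neg C) _ 𝒮 negative-literal) ⟩
  ∣ pos C ∣ * 1 + ∣ neg C ∣ * 1
    ≡⟨ cong₂ _+_ (*-identityʳ ∣ pos C ∣) (*-identityʳ ∣ neg C ∣) ⟩
  ∣ pos C ∣ + ∣ neg C ∣ ∎
  where
  open ≤-Reasoning
  via-pos = union? (pos C) (λ x F → x ∈? neg F)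
  via-neg = union? (neg C) (λ x F → x ∈? pos F)
  positive-literal : ∀ {x} → x ∈ₛ pos C → count (λ F → x ∈? neg F) 𝒮 ≤ 1
  positive-literal x∈C = petals-containing-≤1 neg (λ _ _ → refl) sunflower L∈𝒮 unique
                           (λ x∈L → no-clash (inj₁ (_ , x∈p∩q⁺ (x∈C , x∈L))))
  negative-literal : ∀ {x} → x ∈ₛ neg C → count (λ F → x ∈? pos F) 𝒮 ≤ 1
  negative-literal x∈C = petals-containing-≤1 pos (λ _ _ → refl) sunflower L∈𝒮 unique
                           (λ x∈L → no-clash (inj₂ (_ , x∈p∩q⁺ (x∈C , x∈L))))
  split : Clash C ⊆ Union (pos C) (λ x F → x ∈ₛ neg F) ∪ Union (neg C) (λ x F → x ∈ₛ pos F)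
  split {F} (inj₁ (x , x∈)) = inj₁ (x , x∈p∩q⁻ (pos C) (neg F) x∈)
  split {F} (inj₂ (x , x∈)) = inj₂ (x , x∈p∩q⁻ (neg C) (pos F) x∈)

unclashed-petal : {𝒮 : List (Clause n)} → Unique 𝒮 → IsSunflower 𝒮 → {L : Clause n} → L ∈ 𝒮 →
                  (p : Subset m) (C : Fin m → Clause n) →
                  (∀ {j} → j ∈ₛ p → ∣ pos (C j) ∣ + ∣ neg (C j) ∣ ≤ d) →
                  (∀ {j} → j ∈ₛ p → ¬ Clash (C j) L) →
                  ∣ p ∣ * d + 2 ≤ length 𝒮 →
                  ∃[ F ] F ∈ 𝒮 × F ≢ L × (∀ {j} → j ∈ₛ p → ¬ Clash (C j) F)
unclashed-petal {d = d} {𝒮 = 𝒮} unique sunflower {L} L∈𝒮 p C size no-clash large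
  with count<length⇒∃¬ bad? 𝒮 few-bad
  where
  bad? = (_≟ᶜ L) ∪? union? p (λ j → clash? (C j))
  few-bad : count bad? 𝒮 < length 𝒮
  few-bad = begin-strict
    count bad? 𝒮
      ≤⟨ count-∪ (_≟ᶜ L) (union? p (λ j → clash? (C j))) 𝒮 ⟩
    count (_≟ᶜ L) 𝒮 + count (union? p (λ j → clash? (C j))) 𝒮
      ≤⟨ +-mono-≤ only-L (count-Union p _ 𝒮 clashes-≤d) ⟩
    1 + ∣ p ∣ * d
      <⟨ n<1+n _ ⟩
    2 + ∣ p ∣ * d
      ≡⟨ +-comm 2 (∣ p ∣ * d) ⟩
    ∣ p ∣ * d + 2
      ≤⟨ large ⟩
    length 𝒮 ∎
    where
    open ≤-Reasoning
    only-L : count (_≟ᶜ L) 𝒮 ≤ 1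
    only-L = count-≤1 (_≟ᶜ L) unique (λ _ _ F≡L F′≡L F≢F′ → F≢F′ (trans F≡L (sym F′≡L)))
    clashes-≤d : ∀ {j} → j ∈ₛ p → count (clash? (C j)) 𝒮 ≤ d
    clashes-≤d j∈p = ≤-trans (clashing-petals-≤ unique sunflower L∈𝒮 (C _) (no-clash j∈p)) (size j∈p)
... | F , F∈𝒮 , not-bad = F , F∈𝒮 , (λ F≡L → not-bad (inj₁ F≡L)) , (λ j∈p clash → not-bad (inj₂ (_ , j∈p , clash)))

record IndependentTransversal (G : ClauseGraph n k d V) : Set where
  field
    pick        : Fin k → V
    pick-part   : ∀ j → part G (pick j) ≡ j
    independent : ∀ j j′ → ¬ Adj G (pick j) (pick j′)
open IndependentTransversal

cgis⇔transversal : (G : ClauseGraph n k d V) → CGIS G ⇔ IndependentTransversal G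
cgis⇔transversal {V = V} G = mk⇔ transversal solution
  where
  transversal : CGIS G → IndependentTransversal G
  transversal (S , S-independent , one) = record
    { pick        = chosen
    ; pick-part   = λ j → proj₂ (proj₁ (proj₂ (one j)))
    ; independent = λ j j′ → S-independent (chosen j) (chosen j′) (chosen∈S j) (chosen∈S j′)
    }
    where
    chosen : Fin _ → V
    chosen j = proj₁ (one j)
    chosen∈S : ∀ j → S (chosen j)
    chosen∈S j = proj₁ (proj₁ (proj₂ (one j)))
  solution : IndependentTransversal G → CGIS G
  solution T = S , S-independent , one
    where
    S : V → Set
    S u = pick T (part G u) ≡ u
    S-independent : IsIndependent G S
    S-independent u w Su Sw = independent T (part G u) (part G w) ∘ subst₂ (Adj G) (sym Su) (sym Sw)
    one : OneFromEachPart G S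
    one j = pick T j , (cong (pick T) (pick-part T j) , pick-part T j) ,
            λ w Sw w-part → trans (sym Sw) (cong (pick T) w-part)

transversal-delete⁻ : {G : ClauseGraph n k d V} {v : V} → IndependentTransversal (delete G v) → IndependentTransversal G
transversal-delete⁻ T = record
  { pick        = value ∘ pick T
  ; pick-part   = pick-part T
  ; independent = independent T
  }

transversal-delete⁺ : {G : ClauseGraph n k d V} {v : V} (T : IndependentTransversal G) →
                      pick T (part G v) ≢ v → IndependentTransversal (delete G v)
transversal-delete⁺ {G = G} {v} T pick≢v = record
  { pick        = λ j → pick T j , [ avoids j ]
  ; pick-part   = pick-part T
  ; independent = independent T
  }
  where
  avoids : ∀ j → pick T j ≢ v
  avoids j refl = pick≢v (cong (pick T) (pick-part T j))

adj⇒clash : (G : ClauseGraph n k d V) {u w : V} → Adj G u w → Clash (label G u) (label G w)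
adj⇒clash G = proj₂ ∘ Equivalence.to (adj-iff G _ _)

clash⇒adj : (G : ClauseGraph n k d V) {u w : V} → part G u ≢ part G w → Clash (label G u) (label G w) → Adj G u w
clash⇒adj G parts-differ clash = Equivalence.from (adj-iff G _ _) (parts-differ , clash)

replace : {G : ClauseGraph n k d V} (T : IndependentTransversal G) (w : V) →
          (∀ {j} → j ≢ part G w → ¬ Clash (label G (pick T j)) (label G w)) → IndependentTransversal G
replace {G = G} T w compatible = record
  { pick        = pick′
  ; pick-part   = pick′-part
  ; independent = pick′-independent
  }
  where
  i = part G w
  pick′ = updateAt (pick T) i (const w)
  at-i : pick′ i ≡ w
  at-i = updateAt-updates i (pick T)
  off-i : ∀ {j} → j ≢ i → pick′ j ≡ pick T j
  off-i j≢i = updateAt-minimal _ i (pick T) j≢i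
  pick′-part : ∀ j → part G (pick′ j) ≡ j
  pick′-part j with j ≟ i
  ... | yes refl = cong (part G) at-i
  ... | no j≢i   = trans (cong (part G) (off-i j≢i)) (pick-part T j)
  pick′-independent : ∀ j j′ → ¬ Adj G (pick′ j) (pick′ j′)
  pick′-independent j j′ with j ≟ i | j′ ≟ i
  ... | yes refl | yes refl = λ adj → proj₁ (Equivalence.to (adj-iff G _ _) adj) refl
  ... | yes refl | no j′≢i  = compatible j′≢i ∘ clash-sym ∘ adj⇒clash G ∘ subst₂ (Adj G) at-i (off-i j′≢i)
  ... | no j≢i   | yes refl = compatible j≢i ∘ adj⇒clash G ∘ subst₂ (Adj G) (off-i j≢i) at-i
  ... | no j≢i   | no j′≢i  = independent T j j′ ∘ subst₂ (Adj G) (off-i j≢i) (off-i j′≢i)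

replace-pick : {G : ClauseGraph n k d V} (T : IndependentTransversal G) (w : V) →
               (compatible : ∀ {j} → j ≢ part G w → ¬ Clash (label G (pick T j)) (label G w)) →
               pick (replace T w compatible) (part G w) ≡ w
replace-pick {G = G} T w _ = updateAt-updates (part G w) (pick T)

exchange : (G : ClauseGraph n k d V) {𝒮 : List (Clause n)} {v : V} →
           Unique 𝒮 → All (InLabelsOfPart G (part G v)) 𝒮 → IsSunflower 𝒮 →
           (k ∸ 1) * d + 2 ≤ length 𝒮 → label G v ∈ 𝒮 →
           (T : IndependentTransversal G) → pick T (part G v) ≡ v →
           Σ (IndependentTransversal G) (λ T′ → pick T′ (part G v) ≢ v)
exchange {d = d} G {𝒮} {v} unique petals sunflower large v∈𝒮 T pick≡v
  with unclashed-petal unique sunflower v∈𝒮 (∁ ⁅ part G v ⁆) (label G ∘ pick T)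
                       (λ _ → ≤-reflexive (proj₂ (label-d G _))) others-avoid-v others-large
  where
  others-avoid-v : ∀ {j} → j ∈ₛ ∁ ⁅ part G v ⁆ → ¬ Clash (label G (pick T j)) (label G v)
  others-avoid-v {j} j∈others =
    independent T j (part G v) ∘ clash⇒adj G parts-differ ∘ subst (Clash _) (cong (label G) (sym pick≡v))
    where
    parts-differ : part G (pick T j) ≢ part G (pick T (part G v))
    parts-differ eq = x∉⁅y⁆⇒x≢y (x∈∁p⇒x∉p j∈others) (trans (sym (pick-part T j)) (trans eq (pick-part T _)))
  others-large : ∣ ∁ ⁅ part G v ⁆ ∣ * d + 2 ≤ length 𝒮
  others-large = subst (λ r → r * d + 2 ≤ length 𝒮) (sym (∣∁⁅x⁆∣≡n∸1 (part G v))) large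
... | F , F∈𝒮 , F≢label-v , F-compatible with All.lookup petals F∈𝒮
... | w , w-part , label-w = replace T w compatible , pick′≢v
  where
  compatible : ∀ {j} → j ≢ part G w → ¬ Clash (label G (pick T j)) (label G w)
  compatible j≢ = F-compatible (x∉p⇒x∈∁p (x≢y⇒x∉⁅y⁆ (λ j≡ → j≢ (trans j≡ (sym w-part))))) ∘ subst (Clash _) label-w
  pick′≢v : pick (replace T w compatible) (part G v) ≢ v
  pick′≢v pick′≡v = F≢label-v (trans (sym label-w) (cong (label G) w≡v))
    where
    open ≡-Reasoning
    w≡v : w ≡ v
    w≡v = begin
      w                                           ≡⟨ replace-pick T w compatible ⟨
      pick (replace T w compatible) (part G w)  ≡⟨ cong (pick (replace T w compatible)) w-part ⟩
      pick (replace T w compatible) (part G v)  ≡⟨ pick′≡v ⟩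
      v                                           ∎

lemma5 : ∀ {n k d N : ℕ} (G : ClauseGraph n k d (Fin N)) (i : Fin k)
    (𝒮 : List (Clause n)) →
    Unique 𝒮 →
    All (InLabelsOfPart G i) 𝒮 →
    IsSunflower 𝒮 →
    (k ∸ 1) * d + 2 ≤ length 𝒮 →
    ∀ (v : Fin N) → part G v ≡ i → label G v ∈ 𝒮 →
    (CGIS G ⇔ CGIS (delete G v))
lemma5 G _ _ unique petals sunflower large v refl v∈𝒮 =
  mk⇔ (to-delete ∘ avoid-v ∘ from-G) (to-G ∘ transversal-delete⁻ ∘ from-delete)
  where
  open Equivalence (cgis⇔transversal G) renaming (to to from-G; from to to-G)
  open Equivalence (cgis⇔transversal (delete G v)) renaming (to to from-delete; from to to-delete)
  avoid-v : IndependentTransversal G → IndependentTransversal (delete G v)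
  avoid-v T with pick T (part G v) ≟ v
  ... | no pick≢v  = transversal-delete⁺ T pick≢v
  ... | yes pick≡v = let T′ , pick′≢v = exchange G unique petals sunflower large v∈𝒮 T pick≡v
                     in transversal-delete⁺ T′ pick′≢v
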